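{- Let $n\in\{4,5\}$ and let $A$ be a real $n\times n$ matrix with $\operatorname{rank}(A)\le 2$. Then $\operatorname{dih}(A)=0$.
   Context: For $n\ge1$ and $k=1,\dots,n$, let $\rho_k$ be the permutation of $\{1,\dots,n\}$ with $\rho_k(1)=k,\rho_k(2)=k+1,\dots,\rho_k(n-k+1)=n,\rho_k(n-k+2)=1,\dots,\rho_k(n)=k-1$, and let $\mu_k$ be the permutation with $\mu_k(1)=k,\mu_k(2)=k-1,\dots,\mu_k(k)=1,\mu_k(k+1)=n,\mu_k(k+2)=n-1,\dots,\mu_k(n)=k+1$. For an $n\times n$ matrix $A=(a_{i,j})$, the dihedrant is $$\operatorname{dih}(A)=\sum_{k=1}^n\prod_{i=1}^n a_{i,\rho_k(i)}-\sum_{k=1}^n\prod_{i=1}^n a_{i,\mu_k(i)}.$$ -}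

module Defs where

open import Level using (Level)
open import Data.Nat using (ℕ; zero; suc; _%_)
import Data.Nat as ℕ
open import Data.Nat.DivMod using (m%n<n)
open import Data.Fin using (Fin; zero; suc; toℕ; fromℕ<)
open import Algebra.Bundles using (CommutativeRing)

-- 0-indexed conventions: index i : Fin n stands for the paper's index i+1,
-- and k : Fin n stands for the paper's k+1.

modFin : ∀ {m} → ℕ → Fin (suc m)
modFin {m} x = fromℕ< (m%n<n x (suc m))

-- ρ_k : i ↦ i + k (mod n)   (paper: ρ_k(1)=k, …, ρ_k(n-k+1)=n, ρ_k(n-k+2)=1, …)
ρ : ∀ {n} → Fin n → Fin n → Fin n
ρ {suc m} k i = modFin {m} (toℕ i ℕ.+ toℕ k)

-- μ_k : i ↦ k - i (mod n)   (paper: μ_k(1)=k, …, μ_k(k)=1, μ_k(k+1)=n, …, μ_k(n)=k+1)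
μ : ∀ {n} → Fin n → Fin n → Fin n
μ {suc m} k i = modFin {m} (toℕ k ℕ.+ suc m ℕ.∸ toℕ i)

module OverRing {c ℓ : Level} (R : CommutativeRing c ℓ) where
  open CommutativeRing R using (Carrier; _≈_; _+_; _*_; _-_; 0#; 1#)

  Matrix : ℕ → ℕ → Set c
  Matrix m n = Fin m → Fin n → Carrier

  Σ[_] : ∀ n → (Fin n → Carrier) → Carrier
  Σ[ zero ] f = 0#
  Σ[ suc n ] f = f zero + Σ[ n ] (λ i → f (suc i))

  Π[_] : ∀ n → (Fin n → Carrier) → Carrier
  Π[ zero ] f = 1#
  Π[ suc n ] f = f zero * Π[ n ] (λ i → f (suc i))

  _⊗_ : ∀ {m k n} → Matrix m k → Matrix k n → Matrix m n
  _⊗_ {k = k} B C i j = Σ[ k ] (λ l → B i l * C l j)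

  -- rank(A) ≤ r : A factors as B C with B of size m×r and C of size r×n
  -- (rank = least inner dimension of such a factorization)
  RankAtMost : ∀ {m n} → ℕ → Matrix m n → Set (c Level.⊔ ℓ)
  RankAtMost {m} {n} r A =
    Data.Product.Σ (Matrix m r) λ B → Data.Product.Σ (Matrix r n) λ C →
      ∀ i j → A i j ≈ (B ⊗ C) i j
    where import Data.Product

  dih : ∀ {n} → Matrix n n → Carrier
  dih {n} A = Σ[ n ] (λ k → Π[ n ] (λ i → A i (ρ k i)))
            - Σ[ n ] (λ k → Π[ n ] (λ i → A i (μ k i)))

-- Write a rank-≤ r matrix as A = B C.  Expanding each product Π_i A i (σ i)
-- gives a sum over colourings f : Fin n → Fin r of the column-only factor
-- Π_j C (f j) j times the row factor Π_i B i (f (σ i)), which only sees the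
-- pulled-back colouring f ∘ σ.  Hence two families of permutations have the
-- same diagonal-product sums on all matrices of rank ≤ r as soon as, for every
-- colouring f, the pullbacks f ∘ τ_k are a reindexing of the pullbacks f ∘ σ_k.
-- For r = 2 and the rotations ρ_k and reflections μ_k of Z_n this says that
-- every reflection of a 2-colouring of Z_n is a rotation of it, which holds for
-- n ≤ 5 (it fails for n = 6, e.g. for the subset {0,1,3}).
module Submission where

open import Defs
open import Algebra.Bundles using (CommutativeRing)
import Algebra.Properties.CommutativeMonoid.Sum as CommutativeMonoidSum
open import Data.Nat using (ℕ; zero; suc)
open import Data.Fin using (Fin)
open import Data.Fin.Permutation as Perm using (Permutation′; _⟨$⟩ʳ_; _⟨$⟩ˡ_)
open import Data.Fin.Properties using (all?; any?; _≟_)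
open import Data.Product using (∃; _,_)
open import Data.Sum using (_⊎_; inj₁; inj₂)
open import Data.Vec.Functional using ([]; _∷_; head; tail)
open import Function using (_∘_; id; flip)
open import Relation.Binary.PropositionalEquality as ≡ using (_≡_; _≗_)
open import Relation.Nullary using (Dec)
open import Relation.Nullary.Decidable using (True; map′; toWitness)

ColouringEquivalent : ∀ {m n} → ℕ → (σ τ : Fin m → Fin n → Fin n) → Set
ColouringEquivalent {m} {n} r σ τ =
  ∀ (f : Fin n → Fin r) → ∃ λ (π : Permutation′ m) → ∀ k → f ∘ τ k ≗ f ∘ σ (π ⟨$⟩ʳ k)

module _ {c ℓ} (R : CommutativeRing c ℓ) where
  open CommutativeRing R
  open OverRing R
  open import Algebra.Properties.Semiring.Sum semiring using (*-distribˡ-sum; *-distribʳ-sum)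
  open CommutativeMonoidSum +-commutativeMonoid using (sum; sum-cong-≋; ∑-permute; ∑-comm)
  open CommutativeMonoidSum *-commutativeMonoid
    using () renaming (sum to product; sum-cong-≋ to product-cong-≋; ∑-permute to ∏-permute;
                       ∑-distrib-+ to ∏-distrib-*)
  open import Relation.Binary.Reasoning.Setoid setoid

  Σ≡sum : ∀ n (f : Fin n → Carrier) → Σ[ n ] f ≡ sum f
  Σ≡sum zero    f = ≡.refl
  Σ≡sum (suc n) f = ≡.cong (f Fin.zero +_) (Σ≡sum n (f ∘ Fin.suc))

  Π≡product : ∀ n (f : Fin n → Carrier) → Π[ n ] f ≡ product f
  Π≡product zero    f = ≡.refl
  Π≡product (suc n) f = ≡.cong (f Fin.zero *_) (Π≡product n (f ∘ Fin.suc))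

  sumColourings : ∀ n r → ((Fin n → Fin r) → Carrier) → Carrier
  sumColourings zero    r F = F []
  sumColourings (suc n) r F = sum (λ c → sumColourings n r (F ∘ (c ∷_)))

  sumColourings-cong : ∀ n r {F G : (Fin n → Fin r) → Carrier} →
                       (∀ f → F f ≈ G f) → sumColourings n r F ≈ sumColourings n r G
  sumColourings-cong zero    r F≈G = F≈G []
  sumColourings-cong (suc n) r F≈G = sum-cong-≋ (λ c → sumColourings-cong n r (F≈G ∘ (c ∷_)))

  *-distribˡ-sumColourings : ∀ n r x (F : (Fin n → Fin r) → Carrier) →
                             x * sumColourings n r F ≈ sumColourings n r (λ f → x * F f)
  *-distribˡ-sumColourings zero    r x F = refl
  *-distribˡ-sumColourings (suc n) r x F =
    trans (*-distribˡ-sum x (λ c → sumColourings n r (F ∘ (c ∷_))))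
          (sum-cong-≋ (λ c → *-distribˡ-sumColourings n r x (F ∘ (c ∷_))))

  sum-sumColourings-comm : ∀ m n r (F : Fin m → (Fin n → Fin r) → Carrier) →
    sum (λ k → sumColourings n r (F k)) ≈ sumColourings n r (λ f → sum (λ k → F k f))
  sum-sumColourings-comm m zero    r F = refl
  sum-sumColourings-comm m (suc n) r F =
    trans (∑-comm (λ k c → sumColourings n r (F k ∘ (c ∷_))))
          (sum-cong-≋ (λ c → sum-sumColourings-comm m n r (λ k → F k ∘ (c ∷_))))

  productAlong : ∀ {n m} → Matrix n m → (Fin n → Fin m) → Carrier
  productAlong A f = product (λ i → A i (f i))

  product-sum-expand : ∀ n r (a : Matrix n r) →
                       product (λ i → sum (a i)) ≈ sumColourings n r (productAlong a)
  product-sum-expand zero    r a = refl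
  product-sum-expand (suc n) r a = begin
    sum (a Fin.zero) * product (λ i → sum (a (Fin.suc i)))
      ≈⟨ *-congˡ (product-sum-expand n r (a ∘ Fin.suc)) ⟩
    sum (a Fin.zero) * sumColourings n r (productAlong (a ∘ Fin.suc))
      ≈⟨ *-distribʳ-sum _ (a Fin.zero) ⟩
    sum (λ c → a Fin.zero c * sumColourings n r (productAlong (a ∘ Fin.suc)))
      ≈⟨ sum-cong-≋ (λ c → *-distribˡ-sumColourings n r (a Fin.zero c) _) ⟩
    sumColourings (suc n) r (productAlong a) ∎

  productAlong-reindex : ∀ {n m} (A : Matrix n m) (f : Fin n → Fin m) (σ : Permutation′ n) →
                         productAlong (A ∘ (σ ⟨$⟩ˡ_)) f ≈ productAlong A (f ∘ (σ ⟨$⟩ʳ_))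
  productAlong-reindex A f σ = trans (∏-permute _ σ)
    (product-cong-≋ (λ i → reflexive (≡.cong (λ j → A j (f (σ ⟨$⟩ʳ i))) (Perm.inverseˡ σ))))

  productAlong-⊗ : ∀ {n r} (B : Matrix n r) (C : Matrix r n) (σ : Permutation′ n) →
    productAlong (B ⊗ C) (σ ⟨$⟩ʳ_)
      ≈ sumColourings n r (λ f → productAlong B (f ∘ (σ ⟨$⟩ʳ_)) * productAlong (flip C) f)
  productAlong-⊗ {n} {r} B C σ = begin
    productAlong (B ⊗ C) (σ ⟨$⟩ʳ_)
      ≈⟨ productAlong-reindex (B ⊗ C) id σ ⟨
    product (λ j → Σ[ r ] (λ l → B (σ ⟨$⟩ˡ j) l * C l j))
      ≈⟨ product-cong-≋ (λ j → reflexive (Σ≡sum r (λ l → B (σ ⟨$⟩ˡ j) l * C l j))) ⟩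
    product (λ j → sum (λ l → B (σ ⟨$⟩ˡ j) l * C l j))
      ≈⟨ product-sum-expand n r _ ⟩
    sumColourings n r (productAlong (λ j l → B (σ ⟨$⟩ˡ j) l * C l j))
      ≈⟨ sumColourings-cong n r (λ f → ∏-distrib-* (λ j → B (σ ⟨$⟩ˡ j) (f j)) (λ j → C (f j) j)) ⟩
    sumColourings n r (λ f → productAlong (B ∘ (σ ⟨$⟩ˡ_)) f * productAlong (flip C) f)
      ≈⟨ sumColourings-cong n r (λ f → *-congʳ (productAlong-reindex B f σ)) ⟩
    sumColourings n r (λ f → productAlong B (f ∘ (σ ⟨$⟩ʳ_)) * productAlong (flip C) f) ∎

  sumAlong : ∀ {m n} → Matrix n n → (Fin m → Fin n → Fin n) → Carrier
  sumAlong A σ = sum (λ k → productAlong A (σ k))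

  dih≈sumAlong-difference : ∀ {n} (A : Matrix n n) → dih A ≈ sumAlong A ρ - sumAlong A μ
  dih≈sumAlong-difference {n} A = +-cong (Σ-Π≈sumAlong ρ) (-‿cong (Σ-Π≈sumAlong μ))
    where
    Σ-Π≈sumAlong : ∀ σ → Σ[ n ] (λ k → Π[ n ] (λ i → A i (σ k i))) ≈ sumAlong A σ
    Σ-Π≈sumAlong σ = trans (reflexive (Σ≡sum n _))
                           (sum-cong-≋ (λ k → reflexive (Π≡product n (λ i → A i (σ k i)))))

  ColouringEquivalent⇒sumAlong-≈ : ∀ {m n r} (σ τ : Fin m → Permutation′ n) →
    ColouringEquivalent r (λ k → σ k ⟨$⟩ʳ_) (λ k → τ k ⟨$⟩ʳ_) →
    (A : Matrix n n) → RankAtMost r A →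
    sumAlong A (λ k → σ k ⟨$⟩ʳ_) ≈ sumAlong A (λ k → τ k ⟨$⟩ʳ_)
  ColouringEquivalent⇒sumAlong-≈ {m} {n} {r} σ τ equivalent A (B , C , A≈B⊗C) = begin
    sumAlong A (λ k → σ k ⟨$⟩ʳ_)
      ≈⟨ expand σ ⟩
    sumColourings n r (λ f → sum (λ k → summand f σ k))
      ≈⟨ sumColourings-cong n r (λ f → reindex f (equivalent f)) ⟩
    sumColourings n r (λ f → sum (λ k → summand f τ k))
      ≈⟨ expand τ ⟨
    sumAlong A (λ k → τ k ⟨$⟩ʳ_) ∎
    where
    summand : (Fin n → Fin r) → (Fin m → Permutation′ n) → Fin m → Carrier
    summand f σ k = productAlong B (f ∘ (σ k ⟨$⟩ʳ_)) * productAlong (flip C) f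

    expand : ∀ σ → sumAlong A (λ k → σ k ⟨$⟩ʳ_) ≈ sumColourings n r (λ f → sum (λ k → summand f σ k))
    expand σ = trans
      (sum-cong-≋ (λ k → trans (product-cong-≋ (λ i → A≈B⊗C i _)) (productAlong-⊗ B C (σ k))))
      (sum-sumColourings-comm m n r (λ k f → summand f σ k))

    reindex : ∀ f → ∃ (λ π → ∀ k → f ∘ (τ k ⟨$⟩ʳ_) ≗ f ∘ (σ (π ⟨$⟩ʳ k) ⟨$⟩ʳ_)) →
              sum (λ k → summand f σ k) ≈ sum (λ k → summand f τ k)
    reindex f (π , f∘τ≗f∘σπ) = trans (∑-permute (summand f σ) π)
      (sum-cong-≋ (λ k → *-congʳ (product-cong-≋ (λ i →
        reflexive (≡.cong (B i) (≡.sym (f∘τ≗f∘σπ k i)))))))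

all-colourings? : ∀ {n r p} {P : (Fin n → Fin r) → Set p} →
                  (∀ {f g} → f ≗ g → P f → P g) → (∀ f → Dec (P f)) → Dec (∀ f → P f)
all-colourings? {zero}  resp P? = map′ (λ p f → resp (λ ()) p) (λ h → h []) (P? [])
all-colourings? {suc n} resp P? =
  map′ (λ h f → resp (head∷tail f) (h (head f) (tail f))) (λ h c g → h (c ∷ g))
       (all? λ c → all-colourings? (λ f≗g → resp (∷-cong c f≗g)) (λ g → P? (c ∷ g)))
  where
  head∷tail : ∀ {A : Set} (f : Fin (suc n) → A) → head f ∷ tail f ≗ f
  head∷tail f Fin.zero    = ≡.refl
  head∷tail f (Fin.suc i) = ≡.refl

  ∷-cong : ∀ {A : Set} (c : A) {f g : Fin n → A} → f ≗ g → c ∷ f ≗ c ∷ g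
  ∷-cong c f≗g Fin.zero    = ≡.refl
  ∷-cong c f≗g (Fin.suc i) = f≗g i

by-evaluation : ∀ {p} {P : ℕ → Set p} (P? : ∀ n → Dec (P n)) →
                {True (P? 4)} → {True (P? 5)} → ∀ n → n ≡ 4 ⊎ n ≡ 5 → P n
by-evaluation P? {yes₄}        .4 (inj₁ ≡.refl) = toWitness yes₄
by-evaluation P? {_}    {yes₅} .5 (inj₂ ≡.refl) = toWitness yes₅

-- These three hold for every n ≥ 1; only the sizes needed here are checked.
μ-ρ-inverse : ∀ n → n ≡ 4 ⊎ n ≡ 5 → (k i : Fin n) → μ (ρ k i) k ≡ i
μ-ρ-inverse = by-evaluation λ n → all? λ k → all? λ i → μ (ρ k i) k ≟ i

ρ-μ-inverse : ∀ n → n ≡ 4 ⊎ n ≡ 5 → (k j : Fin n) → ρ k (μ j k) ≡ j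
ρ-μ-inverse = by-evaluation λ n → all? λ k → all? λ j → ρ k (μ j k) ≟ j

μ-involutive : ∀ n → n ≡ 4 ⊎ n ≡ 5 → (k i : Fin n) → μ k (μ k i) ≡ i
μ-involutive = by-evaluation λ n → all? λ k → all? λ i → μ k (μ k i) ≟ i

ReflectionsAreRotations : ∀ {n} → (Fin n → Fin 2) → Set
ReflectionsAreRotations f = ∃ λ t → ∀ k i → f (μ k i) ≡ f (ρ (μ t k) i)

reflections-are-rotations : ∀ n → n ≡ 4 ⊎ n ≡ 5 → (f : Fin n → Fin 2) → ReflectionsAreRotations f
reflections-are-rotations = by-evaluation λ n →
  all-colourings? resp λ f → any? λ t → all? λ k → all? λ i → f (μ k i) ≟ f (ρ (μ t k) i)
  where
  resp : ∀ {n} {f g : Fin n → Fin 2} → f ≗ g → ReflectionsAreRotations f → ReflectionsAreRotations g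
  resp f≗g (t , h) = t , λ k i → ≡.trans (≡.sym (f≗g _)) (≡.trans (h k i) (f≗g _))

module _ {n : ℕ} (n≡4⊎5 : n ≡ 4 ⊎ n ≡ 5) where

  rotation : Fin n → Permutation′ n
  rotation k = Perm.permutation (ρ k) (λ j → μ j k)
                 (ρ-μ-inverse n n≡4⊎5 k) (μ-ρ-inverse n n≡4⊎5 k)

  reflection : Fin n → Permutation′ n
  reflection k = Perm.permutation (μ k) (μ k)
                   (μ-involutive n n≡4⊎5 k) (μ-involutive n n≡4⊎5 k)

  rotations-reflections-equivalent : ColouringEquivalent 2 ρ μ
  rotations-reflections-equivalent f with reflections-are-rotations n n≡4⊎5 f
  ... | t , h = reflection t , h

corollary1 : ∀ {c ℓ} (R : CommutativeRing c ℓ) (n : ℕ) → n ≡ 4 ⊎ n ≡ 5 →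
    (A : OverRing.Matrix R n n) → OverRing.RankAtMost R 2 A →
    CommutativeRing._≈_ R (OverRing.dih R A) (CommutativeRing.0# R)
corollary1 R n n≡4⊎5 A rank≤2 = begin
  dih A                               ≈⟨ dih≈sumAlong-difference R A ⟩
  sumAlong R A ρ - sumAlong R A μ     ≈⟨ +-congʳ rotations≈reflections ⟩
  sumAlong R A μ - sumAlong R A μ     ≈⟨ -‿inverseʳ _ ⟩
  0#                                  ∎
  where
  open CommutativeRing R
  open OverRing R using (dih)
  open import Relation.Binary.Reasoning.Setoid setoid

  rotations≈reflections : sumAlong R A ρ ≈ sumAlong R A μ
  rotations≈reflections = ColouringEquivalent⇒sumAlong-≈ R (rotation n≡4⊎5) (reflection n≡4⊎5)
    (rotations-reflections-equivalent n≡4⊎5) A rank≤2
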